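{- Given a safe invariant $J$ and a correct summary $R$ for the loop $W(t,B)$ w.r.t. precondition $P$ and postcondition $Q$, the predicate $I(s) :\equiv \exists s_0.\ P(s_0)\land J(s)\land\big(\forall s_n.\ R(s,s_n)\implies R(s_0,s_n)\big)$ is a correct invariant for $W(t,B)$ w.r.t. $P$ and $Q$.
   Context: States form a set $S$; commands are relations $C\subseteq S\times\hat S$ with $\hat S = S \uplus \{\mathsf{err}\} \uplus \{\mathrm{brk}(s)\mid s\in S\}$ ($\mathsf{err}$: runtime error outcome; $\mathrm{brk}(s)$: early loop exit via break in state $s$). The loop has test $t\subseteq S$ and body $B\subseteq S\times\hat S$. Invariant $I\subseteq S$ w.r.t. $P$: $P(s_0)\implies I(s_0)$ and $I(s)\land t(s)\land B(s,s')\implies I(s')$; safe: also $I(s)\land t(s)\land B(s,\mathsf{err})\implies\mathit{false}$; correct w.r.t. $Q$: safe and also $I(s)\land t(s)\land B(s,\mathrm{brk}(s_n))\implies Q(s_n)$ and $I(s_n)\land\lnot t(s_n)\implies Q(s_n)$. Summary $R\subseteq S\times S$: $\lnot t(s_n)\implies R(s_n,s_n)$, $t(s)\land B(s,\mathrm{brk}(s_n))\implies R(s,s_n)$, $t(s)\land B(s,s')\land R(s',s_n)\implies R(s,s_n)$; correct w.r.t. $P,Q$: also $P(s_0)\land R(s_0,s_n)\implies Q(s_n)$. -}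

module Defs where

open import Level using (Level; _⊔_; suc)
open import Data.Product using (_×_; ∃; Σ-syntax)
open import Data.Empty using (⊥)

data Ŝ {a} (S : Set a) : Set a where
  nrm : S → Ŝ S
  err : Ŝ S
  brk : S → Ŝ S          -- early loop exit via break in state s

module _ {ℓ : Level} {S : Set ℓ} where

  IsInvariant : (t : S → Set ℓ) (B : S → Ŝ S → Set ℓ) (P I : S → Set ℓ) → Set ℓ
  IsInvariant t B P I =
    (∀ s₀ → P s₀ → I s₀) ×
    (∀ s s' → I s → t s → B s (nrm s') → I s')

  IsSafeInvariant : (t : S → Set ℓ) (B : S → Ŝ S → Set ℓ) (P I : S → Set ℓ) → Set ℓ
  IsSafeInvariant t B P I =
    IsInvariant t B P I ×
    (∀ s → I s → t s → B s err → ⊥)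

  IsCorrectInvariant : (t : S → Set ℓ) (B : S → Ŝ S → Set ℓ) (P Q I : S → Set ℓ) → Set ℓ
  IsCorrectInvariant t B P Q I =
    IsSafeInvariant t B P I ×
    (∀ s sₙ → I s → t s → B s (brk sₙ) → Q sₙ) ×
    (∀ sₙ → I sₙ → (t sₙ → ⊥) → Q sₙ)

  IsSummary : (t : S → Set ℓ) (B : S → Ŝ S → Set ℓ) (R : S → S → Set ℓ) → Set ℓ
  IsSummary t B R =
    (∀ sₙ → (t sₙ → ⊥) → R sₙ sₙ) ×
    (∀ s sₙ → t s → B s (brk sₙ) → R s sₙ) ×
    (∀ s s' sₙ → t s → B s (nrm s') → R s' sₙ → R s sₙ)

  IsCorrectSummary : (t : S → Set ℓ) (B : S → Ŝ S → Set ℓ) (P Q : S → Set ℓ) (R : S → S → Set ℓ) → Set ℓ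
  IsCorrectSummary t B P Q R =
    IsSummary t B R ×
    (∀ s₀ sₙ → P s₀ → R s₀ sₙ → Q sₙ)

  combinedInv : (P J : S → Set ℓ) (R : S → S → Set ℓ) → S → Set ℓ
  combinedInv P J R s = ∃ λ s₀ → P s₀ × J s × (∀ sₙ → R s sₙ → R s₀ sₙ)

{-# OPTIONS --safe #-}
module Submission where

-- The witness s₀ records a start state satisfying P from which every outcome
-- summarised from the current state is also summarised.  Initially s₀ := s,
-- and the summary's step clause lets the same s₀ survive each iteration.  At
-- an exit (or a break) the current state is related by R to the final one, so
-- s₀ is too, and correctness of R yields Q.

open import Level using (Level)
open import Data.Product using (_,_; proj₁)
open import Defs

module _ {ℓ : Level} {S : Set ℓ} (t : S → Set ℓ) (B : S → Ŝ S → Set ℓ)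
         (P J : S → Set ℓ) (R : S → S → Set ℓ) where

  combinedInv-isInvariant : IsInvariant t B P J → IsSummary t B R →
                            IsInvariant t B P (combinedInv P J R)
  combinedInv-isInvariant (J-init , J-step) (_ , _ , R-step) =
      (λ s₀ p → s₀ , p , J-init s₀ p , λ _ r → r)
    , (λ s s' (s₀ , p , j , R-from-s₀) ts b →
         s₀ , p , J-step s s' j ts b ,
         λ sₙ r → R-from-s₀ sₙ (R-step s s' sₙ ts b r))

  combinedInv-isSafeInvariant : IsSafeInvariant t B P J → IsSummary t B R →
                                IsSafeInvariant t B P (combinedInv P J R)
  combinedInv-isSafeInvariant (J-inv , J-safe) R-sum =
      combinedInv-isInvariant J-inv R-sum
    , λ s (_ , _ , j , _) → J-safe s j

  combinedInv-summarised⇒Q : ∀ {Q} → IsCorrectSummary t B P Q R →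
                             ∀ s sₙ → combinedInv P J R s → R s sₙ → Q sₙ
  combinedInv-summarised⇒Q (_ , R-correct) s sₙ (s₀ , p , _ , R-from-s₀) r =
    R-correct s₀ sₙ p (R-from-s₀ sₙ r)

proposition1 : {ℓ : Level} {S : Set ℓ} (t : S → Set ℓ) (B : S → Ŝ S → Set ℓ)
    (P Q J : S → Set ℓ) (R : S → S → Set ℓ) →
    IsSafeInvariant t B P J → IsCorrectSummary t B P Q R →
    IsCorrectInvariant t B P Q (combinedInv P J R)
proposition1 t B P Q J R J-safeInv R-correct@((R-exit , R-brk , _) , _) =
    combinedInv-isSafeInvariant t B P J R J-safeInv (proj₁ R-correct)
  , (λ s sₙ i ts b → summarised⇒Q s sₙ i (R-brk s sₙ ts b))
  , (λ sₙ i ¬t → summarised⇒Q sₙ sₙ i (R-exit sₙ ¬t))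
  where summarised⇒Q = combinedInv-summarised⇒Q t B P J R R-correct
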